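{- Let $(\Pi,O,\mathcal{T})$ be a pseudo-PI-sequence with $n$ states and $k$ actions per state, and let $S\subseteq\{1,\dots,n\}$ be a set of states of cardinality $d$. Then $O$ contains at most $(k-1)^d$ policies $\pi$ with $S^\pi=S$.
   Context: Policies are vectors $\pi\in\{1,\dots,k\}^n$. A collection $U$ of state–action pairs is well-defined if each state appears at most once; then $\pi\oplus U$ is obtained from $\pi$ by setting the action at $s$ to $a$ for each $(s,a)\in U$. A pseudo-PI-sequence of size $m$ is a triple $(\Pi,O,\mathcal{T})$ where: $O$ is a finite sequence of distinct policies, totally ordered by position, with $\pi\prec\pi'$ meaning $\pi$ comes before $\pi'$ in $O$; $\mathcal{T}$ assigns to each policy $\pi$ in $O$ an abstract improvement set $T^\pi$, a set of pairs $(s,a)$ with $a\neq\pi(s)$, and $S^\pi$ denotes the set of states appearing in $T^\pi$; and $\Pi=\pi_0,\dots,\pi_{m-1}$ is a subsequence of $O$. It is required that: (i) for any two policies $\pi\prec\pi'$ in $O$ there is a state $s\in S^\pi$ with $\pi(s)\ne\pi'(s)$ and $(s,\pi(s))\notin T^{\pi'}$; (ii) for each $0\le i<m-1$, $O$ contains at least $|S^{\pi_i}|$ policies $\pi$ with $\pi_i\prec\pi\prec\pi_{i+1}$. -}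

module Defs where

open import Data.Nat using (ℕ; zero; suc; _≤_; _<_; _∸_)
open import Data.Bool using (Bool; true; false; _∨_)
open import Data.Fin using (Fin; toℕ)
open import Data.Fin.Subset using (Subset; _∈_; _∉_; ∣_∣)
open import Data.Vec using (Vec; []; _∷_; lookup; tabulate; map)
open import Data.Product using (_×_)
open import Relation.Binary.PropositionalEquality using (_≡_; _≢_)
open import Relation.Nullary using (¬_)
open import Relation.Nullary.Decidable using (⌊_⌋)
open import Data.Vec.Properties using (≡-dec)
open import Data.Fin.Properties using (_≟_)
open import Data.Product using (∃-syntax)

-- A policy on n states with k actions per state: action π(s) ∈ Fin k (actions 1..k ↦ 0..k-1).
Policy : ℕ → ℕ → Set
Policy n k = Vec (Fin k) n

ImpSet : ℕ → ℕ → Set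
ImpSet n k = Vec (Subset k) n

_∈T_ : ∀ {n k} → Fin n × Fin k → ImpSet n k → Set
(s Data.Product., a) ∈T T = a ∈ lookup T s

nonempty : ∀ {k} → Subset k → Bool
nonempty []       = false
nonempty (b ∷ bs) = b ∨ nonempty bs

states : ∀ {n k} → ImpSet n k → Subset n
states T = map nonempty T

-- O is given as a sequence of L policies (positions Fin L, ordered by toℕ);
-- T assigns to position p the improvement set of policy O p;
-- Π is the subsequence given by strictly increasing positions idx : Fin m → Fin L.
record PseudoPISeq (n k m : ℕ) : Set where
  field
    L     : ℕ
    O     : Fin L → Policy n k
    T     : Fin L → ImpSet n k
    idx   : Fin m → Fin L
    O-distinct : ∀ p q → O p ≡ O q → p ≡ q
    T-valid : ∀ p (s : Fin n) → lookup (O p) s ∉ lookup (T p) s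
    idx-mono : ∀ (i j : Fin m) → toℕ i < toℕ j → toℕ (idx i) < toℕ (idx j)
    cond-i : ∀ p q → toℕ p < toℕ q →
             ∃[ s ] (s ∈ states (T p)
                     × lookup (O p) s ≢ lookup (O q) s
                     × lookup (O p) s ∉ lookup (T q) s)
    cond-ii : ∀ (i j : Fin m) → suc (toℕ i) ≡ toℕ j →
              ∣ states (T (idx i)) ∣ ≤ toℕ (idx j) ∸ suc (toℕ (idx i))

positionsWith : ∀ {n k m} (P : PseudoPISeq n k m) → Subset n → Subset (PseudoPISeq.L P)
positionsWith P S = tabulate λ p → ⌊ ≡-dec Data.Bool._≟_ (states (PseudoPISeq.T P p)) S ⌋

-- Pick, for every policy π of O with S^π = S, an action b_π(s) ∈ T^π(s) at each s ∈ S, and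
-- let B_π = ∏_{s ∈ S} {π(s), b_π(s)}. Then π ∈ B_π, while condition (i) places every earlier
-- policy of O outside B_π. Over GF(2) the indicators of such boxes lie in the d-th tensor power
-- of the (k - 1)-dimensional span of the pair indicators [x ∈ {0, c}], c ≠ 0, and the triangular
-- incidence pattern makes the indicators of the boxes B_π linearly independent; hence there are
-- at most (k - 1)^d of them.

module Submission where

open import Algebra.Bundles using (CommutativeRing)
open import Data.Bool using (Bool; true; false; _∧_; _∨_; _xor_)
open import Data.Bool.Properties
  using (xor-∧-commutativeRing; ∧-assoc; ∧-comm; ∧-distribˡ-xor; ∧-zeroʳ; ∧-identityʳ; ∨-comm; T-≡)
open import Data.Empty using (⊥-elim)
open import Data.Fin using (Fin; zero; suc; toℕ; remQuot; combine; funToFin; finToFun)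
open import Data.Fin.Properties
  using (_≟_; 2↔Bool; remQuot-combine; funToFin-finToFin; finToFun-funToFin; injective⇒≤)
open import Data.Fin.Subset using (Subset; _∈_; ∣_∣; Nonempty)
open import Data.Fin.Subset.Properties using (nonempty?)
open import Data.Nat using (ℕ; zero; suc; _*_; _∸_; _^_; _≤_; _<_; z<s; s<s; s≤s; z≤n)
open import Data.Nat.Properties using (≮⇒≥; <⇒≱; ^-monoʳ-<)
open import Data.Product using (_×_; _,_; proj₁; proj₂; uncurry)
import Data.Product as Product
open import Data.Vec using (Vec; []; _∷_; here; there; lookup; tail; uncons; tabulate)
open import Data.Vec.Properties using ([]=⇒lookup; lookup-map; lookup∘tabulate)
open import Function using (_∘_; Inverse; Injection; Equivalence)
open import Function.Properties.Inverse using (↔-sym; ↔⇒↣)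
open import Relation.Binary.PropositionalEquality
open import Relation.Nullary using (yes; no; does)
open import Relation.Nullary.Decidable using (dec-true; dec-false; toWitness)

open import Defs

module GF2 = CommutativeRing xor-∧-commutativeRing
open import Algebra.Properties.Semiring.Sum GF2.semiring using (sum; ∑-distrib-+; sum-cong-≗)
open import Algebra.Properties.Group GF2.+-group using (∙-cancelʳ)

private variable
  k n M N : ℕ
  A B X : Set

pairing : (Fin N → X) → (Fin N → Bool) → (X → Bool) → Bool
pairing x Λ f = sum λ i → Λ i ∧ f (x i)

pairing-cong : (x : Fin N → X) (Λ : Fin N → Bool) {f g : X → Bool} → f ≗ g → pairing x Λ f ≡ pairing x Λ g
pairing-cong x Λ f≗g = sum-cong-≗ λ i → cong (Λ i ∧_) (f≗g (x i))

-- Span over GF(2) = (Bool, xor, ∧), characterised dually: f cannot separate two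
-- weighted point sets that no basis function e c separates.
record _∈Span_ {X : Set} (f : X → Bool) (e : Fin M → X → Bool) : Set where
  constructor mk∈Span
  field
    pairing-agrees : (x : Fin N → X) (Λ Λ′ : Fin N → Bool) →
      (∀ c → pairing x Λ (e c) ≡ pairing x Λ′ (e c)) → pairing x Λ f ≡ pairing x Λ′ f

open _∈Span_

infix 4 _∈Span_
infixr 7 _⊠_ _⊗_

∈Span-basis : (e : Fin M → X → Bool) (c : Fin M) → e c ∈Span e
∈Span-basis e c = mk∈Span λ x Λ Λ′ same → same c

∈Span-resp-≗ : {e : Fin M → X → Bool} {f g : X → Bool} → f ≗ g → f ∈Span e → g ∈Span e
∈Span-resp-≗ f≗g f∈ = mk∈Span λ x Λ Λ′ same →
  trans (sym (pairing-cong x Λ f≗g)) (trans (pairing-agrees f∈ x Λ Λ′ same) (pairing-cong x Λ′ f≗g))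

pairing-xor : (x : Fin N → X) (Λ : Fin N → Bool) (f g : X → Bool) →
  pairing x Λ (λ y → f y xor g y) ≡ pairing x Λ f xor pairing x Λ g
pairing-xor x Λ f g = trans (sum-cong-≗ λ i → ∧-distribˡ-xor (Λ i) (f (x i)) (g (x i)))
                            (∑-distrib-+ (λ i → Λ i ∧ f (x i)) (λ i → Λ i ∧ g (x i)))

∈Span-xor : {e : Fin M → X → Bool} {f g : X → Bool} →
  f ∈Span e → g ∈Span e → (λ y → f y xor g y) ∈Span e
∈Span-xor {f = f} {g} f∈ g∈ = mk∈Span λ x Λ Λ′ same → let open ≡-Reasoning in begin
  pairing x Λ (λ y → f y xor g y)    ≡⟨ pairing-xor x Λ f g ⟩
  pairing x Λ f xor pairing x Λ g    ≡⟨ cong₂ _xor_ (pairing-agrees f∈ x Λ Λ′ same) (pairing-agrees g∈ x Λ Λ′ same) ⟩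
  pairing x Λ′ f xor pairing x Λ′ g  ≡⟨ pairing-xor x Λ′ f g ⟨
  pairing x Λ′ (λ y → f y xor g y)   ∎

∈Span-∘ : {e : Fin M → X → Bool} {f : X → Bool} (h : A → X) →
  f ∈Span e → (f ∘ h) ∈Span (λ c → e c ∘ h)
∈Span-∘ h f∈ = mk∈Span λ x → pairing-agrees f∈ (h ∘ x)

_⊠_ : (A → Bool) → (B → Bool) → A × B → Bool
(u ⊠ w) (a , b) = u a ∧ w b

_⊗_ : (Fin M → A → Bool) → (Fin N → B → Bool) → Fin (M * N) → A × B → Bool
_⊗_ {N = N} e e′ c = uncurry (λ d d′ → e d ⊠ e′ d′) (remQuot N c)

⊗-combine : (e : Fin M → A → Bool) (e′ : Fin N → B → Bool) (c : Fin M) (c′ : Fin N) →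
  (e ⊗ e′) (combine c c′) ≡ e c ⊠ e′ c′
⊗-combine e e′ c c′ = cong (uncurry λ d d′ → e d ⊠ e′ d′) (remQuot-combine c c′)

pairing-absorbˡ : (x : Fin N → A × B) (Λ : Fin N → Bool) (u : A → Bool) (w : B → Bool) →
  pairing x Λ (u ⊠ w) ≡ pairing (proj₂ ∘ x) (λ i → Λ i ∧ u (proj₁ (x i))) w
pairing-absorbˡ x Λ u w = sum-cong-≗ λ i → sym (∧-assoc (Λ i) _ _)

pairing-absorbʳ : (x : Fin N → A × B) (Λ : Fin N → Bool) (u : A → Bool) (w : B → Bool) →
  pairing x Λ (u ⊠ w) ≡ pairing (proj₁ ∘ x) (λ i → Λ i ∧ w (proj₂ (x i))) u
pairing-absorbʳ x Λ u w = sum-cong-≗ λ i →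
  trans (cong (Λ i ∧_) (∧-comm (u (proj₁ (x i))) _)) (sym (∧-assoc (Λ i) _ _))

-- One factor at a time: reweighting by e c turns agreement on e c ⊠ e′ c′ into agreement on
-- e c ⊠ g, and reweighting by g then turns that into agreement on f ⊠ g.
∈Span-⊗ : {e : Fin M → A → Bool} {e′ : Fin N → B → Bool} {f : A → Bool} {g : B → Bool} →
  f ∈Span e → g ∈Span e′ → f ⊠ g ∈Span e ⊗ e′
∈Span-⊗ {A = A} {B = B} {e = e} {e′} {f} {g} f∈ g∈ = mk∈Span agrees
  where
  agrees : (x : Fin N → A × B) (Λ Λ′ : Fin N → Bool) →
    (∀ c → pairing x Λ ((e ⊗ e′) c) ≡ pairing x Λ′ ((e ⊗ e′) c)) →
    pairing x Λ (f ⊠ g) ≡ pairing x Λ′ (f ⊠ g)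
  agrees x Λ Λ′ same = begin
    pairing x Λ (f ⊠ g)                                  ≡⟨ pairing-absorbʳ x Λ f g ⟩
    pairing (proj₁ ∘ x) (λ i → Λ i ∧ g (proj₂ (x i))) f   ≡⟨ pairing-agrees f∈ (proj₁ ∘ x) _ _ same-f ⟩
    pairing (proj₁ ∘ x) (λ i → Λ′ i ∧ g (proj₂ (x i))) f  ≡⟨ pairing-absorbʳ x Λ′ f g ⟨
    pairing x Λ′ (f ⊠ g)                                 ∎
    where
    open ≡-Reasoning
    same-⊠ : ∀ c c′ → pairing x Λ (e c ⊠ e′ c′) ≡ pairing x Λ′ (e c ⊠ e′ c′)
    same-⊠ c c′ = subst (λ h → pairing x Λ h ≡ pairing x Λ′ h) (⊗-combine e e′ c c′) (same (combine c c′))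

    same-g : ∀ c → pairing x Λ (e c ⊠ g) ≡ pairing x Λ′ (e c ⊠ g)
    same-g c = begin
      pairing x Λ (e c ⊠ g)                                  ≡⟨ pairing-absorbˡ x Λ (e c) g ⟩
      pairing (proj₂ ∘ x) (λ i → Λ i ∧ e c (proj₁ (x i))) g   ≡⟨ pairing-agrees g∈ (proj₂ ∘ x) _ _ same-e′ ⟩
      pairing (proj₂ ∘ x) (λ i → Λ′ i ∧ e c (proj₁ (x i))) g  ≡⟨ pairing-absorbˡ x Λ′ (e c) g ⟨
      pairing x Λ′ (e c ⊠ g)                                 ∎
      where
      same-e′ : ∀ c′ → pairing (proj₂ ∘ x) (λ i → Λ i ∧ e c (proj₁ (x i))) (e′ c′)
                     ≡ pairing (proj₂ ∘ x) (λ i → Λ′ i ∧ e c (proj₁ (x i))) (e′ c′)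
      same-e′ c′ = trans (sym (pairing-absorbˡ x Λ (e c) (e′ c′)))
                         (trans (same-⊠ c c′) (pairing-absorbˡ x Λ′ (e c) (e′ c′)))

    same-f : ∀ c → pairing (proj₁ ∘ x) (λ i → Λ i ∧ g (proj₂ (x i))) (e c)
                 ≡ pairing (proj₁ ∘ x) (λ i → Λ′ i ∧ g (proj₂ (x i))) (e c)
    same-f c = trans (sym (pairing-absorbʳ x Λ (e c) g))
                     (trans (same-g c) (pairing-absorbʳ x Λ′ (e c) g))

triangular-injective : (x : Fin N → X) (f : Fin N → X → Bool) →
  (∀ i → f i (x i) ≡ true) → (∀ {i j} → toℕ i < toℕ j → f j (x i) ≡ false) →
  (Λ Λ′ : Fin N → Bool) → (∀ j → pairing x Λ (f j) ≡ pairing x Λ′ (f j)) → Λ ≗ Λ′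
triangular-injective {N = zero}  x f diag upper Λ Λ′ same ()
triangular-injective {N = suc N} x f diag upper Λ Λ′ same = λ where
    zero    → ∙-cancelʳ (pairing (x ∘ suc) (Λ ∘ suc) (f zero)) (Λ zero) (Λ′ zero) same-head
    (suc i) → tail≗ i
  where
  -- f j (x 0) = false for j > 0, so the first point drops out of the later tests.
  drop-head : ∀ Λ j → pairing x Λ (f (suc j)) ≡ pairing (x ∘ suc) (Λ ∘ suc) (f (suc j))
  drop-head Λ j = cong (_xor pairing (x ∘ suc) (Λ ∘ suc) (f (suc j)))
                       (trans (cong (Λ zero ∧_) (upper z<s)) (∧-zeroʳ (Λ zero)))

  tail≗ : Λ ∘ suc ≗ Λ′ ∘ suc
  tail≗ = triangular-injective (x ∘ suc) (f ∘ suc) (diag ∘ suc) (upper ∘ s<s) (Λ ∘ suc) (Λ′ ∘ suc)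
    λ j → trans (sym (drop-head Λ j)) (trans (same (suc j)) (drop-head Λ′ j))

  head-term : ∀ Λ → Λ zero ∧ f zero (x zero) ≡ Λ zero
  head-term Λ = trans (cong (Λ zero ∧_) (diag zero)) (∧-identityʳ (Λ zero))

  same-head : Λ zero xor pairing (x ∘ suc) (Λ ∘ suc) (f zero)
            ≡ Λ′ zero xor pairing (x ∘ suc) (Λ ∘ suc) (f zero)
  same-head = subst₂ _≡_
    (cong (_xor pairing (x ∘ suc) (Λ ∘ suc) (f zero)) (head-term Λ))
    (cong₂ _xor_ (head-term Λ′) (sum-cong-≗ λ i → cong (_∧ f zero (x (suc i))) (sym (tail≗ i))))
    (same zero)

funToFin-cong : {f g : Fin M → Fin N} → f ≗ g → funToFin f ≡ funToFin g
funToFin-cong {M = zero}  f≗g = refl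
funToFin-cong {M = suc M} f≗g = cong₂ combine (f≗g zero) (funToFin-cong (f≗g ∘ suc))

-- Coding Boolean vectors as elements of Fin (2 ^ N) makes g an injection Fin (2 ^ N) → Fin (2 ^ M).
≗-injective⇒≤ : (g : (Fin N → Bool) → (Fin M → Bool)) → (∀ {u v} → g u ≗ g v → u ≗ v) → N ≤ M
≗-injective⇒≤ {N = N} {M = M} g g-injective =
  ≮⇒≥ λ M<N → <⇒≱ (^-monoʳ-< 2 (s≤s (s≤s z≤n)) M<N) (injective⇒≤ h-injective)
  where
  open Inverse 2↔Bool using (to; from)
  from-injective : ∀ {a b} → from a ≡ from b → a ≡ b
  from-injective = Injection.injective (↔⇒↣ (↔-sym 2↔Bool))
  to-injective : ∀ {a b} → to a ≡ to b → a ≡ b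
  to-injective = Injection.injective (↔⇒↣ 2↔Bool)

  bits : Fin (2 ^ N) → Fin N → Fin 2
  bits = finToFun

  decode : Fin (2 ^ N) → Fin N → Bool
  decode i = to ∘ bits i

  h : Fin (2 ^ N) → Fin (2 ^ M)
  h i = funToFin (from ∘ g (decode i))

  h-injective : ∀ {i j} → h i ≡ h j → i ≡ j
  h-injective {i} {j} hi≡hj = begin
    i                  ≡⟨ funToFin-finToFin {N} i ⟨
    funToFin (bits i)  ≡⟨ funToFin-cong (λ c → to-injective (g-injective g≗ c)) ⟩
    funToFin (bits j)  ≡⟨ funToFin-finToFin {N} j ⟩
    j                  ∎
    where
    open ≡-Reasoning
    g≗ : g (decode i) ≗ g (decode j)
    g≗ c = from-injective (begin
      from (g (decode i) c)        ≡⟨ finToFun-funToFin (from ∘ g (decode i)) c ⟨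
      finToFun (h i) c             ≡⟨ cong (λ k → finToFun k c) hi≡hj ⟩
      finToFun (h j) c             ≡⟨ finToFun-funToFin (from ∘ g (decode j)) c ⟩
      from (g (decode j) c)        ∎)

triangular⇒≤ : (e : Fin M → X → Bool) (x : Fin N → X) (f : Fin N → X → Bool) →
  (∀ j → f j ∈Span e) →
  (∀ i → f i (x i) ≡ true) → (∀ {i j} → toℕ i < toℕ j → f j (x i) ≡ false) → N ≤ M
triangular⇒≤ e x f f∈ diag upper = ≗-injective⇒≤ (λ Λ c → pairing x Λ (e c))
  λ same → triangular-injective x f diag upper _ _ λ j → pairing-agrees (f∈ j) x _ _ same

inPair : Fin k → Fin k → Fin k → Bool
inPair a b y = does (y ≟ a) ∨ does (y ≟ b)

pairBasis : ∀ k → Fin (k ∸ 1) → Fin k → Bool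
pairBasis (suc k) c = inPair zero (suc c)

xor-inPair : {a b : Fin k} → a ≢ b → (y : Fin k) → does (y ≟ a) xor does (y ≟ b) ≡ inPair a b y
xor-inPair {a = a} {b} a≢b y with y ≟ a | y ≟ b
... | yes refl | yes refl = ⊥-elim (a≢b refl)
... | yes _    | no _     = refl
... | no _     | _        = refl

inPair-∈Span : {a b : Fin k} → a ≢ b → inPair a b ∈Span pairBasis k
inPair-∈Span {a = zero}  {zero}  a≢b = ⊥-elim (a≢b refl)
inPair-∈Span {k = suc k} {a = zero}  {suc b} _   = ∈Span-basis (pairBasis (suc k)) b
inPair-∈Span {k = suc k} {a = suc a} {zero}  _   =
  ∈Span-resp-≗ (λ y → ∨-comm (does (y ≟ zero)) _) (∈Span-basis _ a)
inPair-∈Span {k = suc k} {a = suc a} {suc b} a≢b =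
  ∈Span-resp-≗ pairs (∈Span-xor (∈Span-basis _ a) (∈Span-basis _ b))
  where
  pairs : (y : Fin _) → inPair zero (suc a) y xor inPair zero (suc b) y ≡ inPair (suc a) (suc b) y
  pairs zero    = refl
  pairs (suc y) = xor-inPair (λ a≡b → a≢b (cong suc a≡b)) y

inBox : Subset n → Vec (Fin k) n → Vec (Fin k) n → Vec (Fin k) n → Bool
inBox []          []        []        []        = true
inBox (false ∷ S) (_ ∷ a)   (_ ∷ b)   (_ ∷ y)   = inBox S a b y
inBox (true ∷ S)  (a₀ ∷ a)  (b₀ ∷ b)  (y₀ ∷ y)  = inPair a₀ b₀ y₀ ∧ inBox S a b y

boxBasis : (S : Subset n) → Fin ((k ∸ 1) ^ ∣ S ∣) → Vec (Fin k) n → Bool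
boxBasis []          _ _ = true
boxBasis (false ∷ S) c   = boxBasis S c ∘ tail
boxBasis (true ∷ S)  c   = (pairBasis _ ⊗ boxBasis S) c ∘ uncons

inBox-∈Span : (S : Subset n) (a b : Vec (Fin k) n) →
  (∀ {s} → s ∈ S → lookup a s ≢ lookup b s) → inBox S a b ∈Span boxBasis S
inBox-∈Span {k = k} [] [] [] _ =
  ∈Span-resp-≗ (λ { [] → refl }) (∈Span-basis (boxBasis {k = k} []) zero)
inBox-∈Span (false ∷ S) (_ ∷ a) (_ ∷ b) apart =
  ∈Span-resp-≗ (λ { (_ ∷ _) → refl })
    (∈Span-∘ tail (inBox-∈Span S a b (apart ∘ there)))
inBox-∈Span (true ∷ S) (_ ∷ a) (_ ∷ b) apart =
  ∈Span-resp-≗ (λ { (_ ∷ _) → refl })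
    (∈Span-∘ uncons (∈Span-⊗ (inPair-∈Span (apart here)) (inBox-∈Span S a b (apart ∘ there))))

inBox-diag : (S : Subset n) (a b : Vec (Fin k) n) → inBox S a b a ≡ true
inBox-diag []          []       []      = refl
inBox-diag (false ∷ S) (_ ∷ a)  (_ ∷ b) = inBox-diag S a b
inBox-diag (true ∷ S)  (a₀ ∷ a) (_ ∷ b)
  rewrite dec-true (a₀ ≟ a₀) refl = inBox-diag S a b

inBox-outside : (S : Subset n) (a b y : Vec (Fin k) n) {s : Fin n} → s ∈ S →
  lookup y s ≢ lookup a s → lookup y s ≢ lookup b s → inBox S a b y ≡ false
inBox-outside (true ∷ S) (a₀ ∷ _) (b₀ ∷ _) (y₀ ∷ _) here y≢a y≢b
  rewrite dec-false (y₀ ≟ a₀) y≢a | dec-false (y₀ ≟ b₀) y≢b = refl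
inBox-outside (false ∷ S) (_ ∷ a) (_ ∷ b) (_ ∷ y) (there s∈S) y≢a y≢b =
  inBox-outside S a b y s∈S y≢a y≢b
inBox-outside (true ∷ S) (_ ∷ a) (_ ∷ b) (y₀ ∷ y) (there s∈S) y≢a y≢b
  rewrite inBox-outside S a b y s∈S y≢a y≢b = ∧-zeroʳ _

nonempty⇒Nonempty : (t : Subset k) → nonempty t ≡ true → Nonempty t
nonempty⇒Nonempty (true ∷ t)  _  = zero , here
nonempty⇒Nonempty (false ∷ t) ne = Product.map suc there (nonempty⇒Nonempty t ne)

∈states⇒Nonempty : (T : ImpSet n k) {s : Fin n} → s ∈ states T → Nonempty (lookup T s)
∈states⇒Nonempty T {s} s∈ = nonempty⇒Nonempty (lookup T s) (trans (sym (lookup-map s nonempty T)) ([]=⇒lookup s∈))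

-- An element of t, or the junk value a₀ when t is empty.
pick : Subset k → Fin k → Fin k
pick t a₀ with nonempty? t
... | yes (a , _) = a
... | no _        = a₀

pick-∈ : (t : Subset k) (a₀ : Fin k) → Nonempty t → pick t a₀ ∈ t
pick-∈ t a₀ ne with nonempty? t
... | yes (_ , a∈t) = a∈t
... | no ¬ne        = ⊥-elim (¬ne ne)

improvement : Policy n k → ImpSet n k → Policy n k
improvement π T = tabulate λ s → pick (lookup T s) (lookup π s)

improvement-∈ : (π : Policy n k) (T : ImpSet n k) {s : Fin n} → s ∈ states T →
  lookup (improvement π T) s ∈ lookup T s
improvement-∈ π T {s} s∈ rewrite lookup∘tabulate (λ s → pick (lookup T s) (lookup π s)) s =
  pick-∈ (lookup T s) (lookup π s) (∈states⇒Nonempty T s∈)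

enumerate : (v : Subset n) → Fin ∣ v ∣ → Fin n
enumerate (true ∷ v)  zero    = zero
enumerate (true ∷ v)  (suc i) = suc (enumerate v i)
enumerate (false ∷ v) i       = suc (enumerate v i)

enumerate-∈ : (v : Subset n) (i : Fin ∣ v ∣) → enumerate v i ∈ v
enumerate-∈ (true ∷ v)  zero    = here
enumerate-∈ (true ∷ v)  (suc i) = there (enumerate-∈ v i)
enumerate-∈ (false ∷ v) i       = there (enumerate-∈ v i)

enumerate-mono : (v : Subset n) {i j : Fin ∣ v ∣} →
  toℕ i < toℕ j → toℕ (enumerate v i) < toℕ (enumerate v j)
enumerate-mono (true ∷ v)  {zero}  {suc j} _         = z<s
enumerate-mono (true ∷ v)  {suc i} {suc j} (s<s i<j) = s<s (enumerate-mono v i<j)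
enumerate-mono (false ∷ v)                 i<j       = s<s (enumerate-mono v i<j)

module _ {n k m : ℕ} (P : PseudoPISeq n k m) where
  open PseudoPISeq P

  improvement-apart : (p : Fin L) {s : Fin n} → s ∈ states (T p) →
    lookup (O p) s ≢ lookup (improvement (O p) (T p)) s
  improvement-apart p {s} s∈ O≡imp =
    T-valid p s (subst (_∈ lookup (T p) s) (sym O≡imp) (improvement-∈ (O p) (T p) s∈))

  positionsWith-states : (S : Subset n) {p : Fin L} → p ∈ positionsWith P S → states (T p) ≡ S
  positionsWith-states S {p} p∈ = toWitness (Equivalence.from T-≡
    (trans (sym (lookup∘tabulate _ p)) ([]=⇒lookup p∈)))

  box : Subset n → Fin L → Policy n k → Bool
  box S p = inBox S (O p) (improvement (O p) (T p))

  box-∈Span : {S : Subset n} (p : Fin L) → states (T p) ≡ S → box S p ∈Span boxBasis S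
  box-∈Span p refl = inBox-∈Span _ _ _ (improvement-apart p)

  box-diag : (S : Subset n) (p : Fin L) → box S p (O p) ≡ true
  box-diag S p = inBox-diag S _ _

  -- Condition (i) yields a state of S where O p lies on neither side of the box of a later q.
  box-earlier : {S : Subset n} {p q : Fin L} → toℕ p < toℕ q →
    states (T p) ≡ S → states (T q) ≡ S → box S q (O p) ≡ false
  box-earlier {S} {p} {q} p<q Sp Sq with cond-i p q p<q
  ... | s , s∈Sp , Op≢Oq , Op∉Tq =
    inBox-outside S _ _ _ s∈S Op≢Oq λ Op≡bq →
      Op∉Tq (subst (_∈ lookup (T q) s) (sym Op≡bq) (improvement-∈ (O q) (T q) (subst (s ∈_) (sym Sq) s∈S)))
    where
    s∈S : s ∈ S
    s∈S = subst (s ∈_) Sp s∈Sp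

proposition5 : ∀ {n k m : ℕ} (P : PseudoPISeq n k m) (S : Subset n) (d : ℕ) →
    ∣ S ∣ ≡ d → ∣ positionsWith P S ∣ ≤ (k ∸ 1) ^ d
proposition5 P S d refl =
  triangular⇒≤ (boxBasis S) (O ∘ position) (box P S ∘ position)
    (λ j → box-∈Span P (position j) (support j))
    (λ i → box-diag P S (position i))
    (λ i<j → box-earlier P (enumerate-mono _ i<j) (support _) (support _))
  where
  open PseudoPISeq P
  position : Fin ∣ positionsWith P S ∣ → Fin L
  position = enumerate (positionsWith P S)
  support : ∀ i → states (T (position i)) ≡ S
  support i = positionsWith-states P S (enumerate-∈ _ i)
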